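{- The trace semantics of a $\mathbb{T}$-automaton and of its CPS-transform agree: for every $\mathbb{T}$-automaton $m$ with state set $X$ and every state $x\in X$, $[\![x]\!]_m=[\![x]\!]_{m_*}$.
   Context: $A$ finite, $L=B\times(-)^A$ with final coalgebra $B^{A^*}$. A $\mathbb{T}$-automaton $m$ ($\mathbb{T}$ a monad on $\mathbf{Set}$, $B$ a finitely generated $\mathbb{T}$-algebra) consists of a finite set $X$, maps $o^m:X\to B$, $t^m:A\times X\to TX$ and a $\mathbb{T}$-algebra $a^m:TB\to B$; its trace semantics $[\![x]\!]_m$ is the image of $\eta(x)$ under the unique $L$-coalgebra morphism $TX\to B^{A^*}$, where $TX$ carries the $L$-coalgebra structure given by the unique $\mathbb{T}$-algebra morphism $TX\to B\times(TX)^A$ extending $\langle o^m,t^m\rangle$ along $\eta$ (pointwise algebra structure on the codomain). Let $\mathbb{T}_B$ be the continuation monad $T_BX=B^{(B^X)}$ (unit $\eta(x)=\lambda f.f(x)$, lifting $f^\ast(k)=\lambda c.\,k(\lambda x.f(x)(c))$), and $\kappa:\mathbb{T}\to\mathbb{T}_B$ the monad morphism $\kappa_X(p)=\lambda f.\,a^m(Tf(p))$. The CPS-transform $m_*:X\to B\times(T_BX)^A$ is the $\mathbb{T}_B$-automaton with $o^{m_*}=o^m$, $t^{m_*}=\kappa_X\circ t^m$ and $a^{m_*}=\lambda t.\,t(\mathrm{id}):T_BB\to B$; its trace semantics is defined by the same generalized powerset construction with $\mathbb{T}_B$ in place of $\mathbb{T}$ (even though $\mathbb{T}_B$ need not be finitary).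 -}

module Defs where

open import Data.Nat using (ℕ)
open import Data.Fin using (Fin)
open import Data.List using (List; []; _∷_)
open import Data.Product using (Σ; ∃; _,_)
open import Function using (_∘_; id)
open import Relation.Binary.PropositionalEquality using (_≡_)

record MonadOps : Set₁ where
  field
    T    : Set → Set
    η    : {X : Set} → X → T X
    bind : {X Y : Set} → T X → (X → T Y) → T Y

  fmap : {X Y : Set} → (X → Y) → T X → T Y
  fmap f p = bind p (η ∘ f)

-- Monad laws (pointwise, since Agda has no function extensionality;
-- bind-cong says bind respects pointwise equality of Kleisli maps).
record IsMonad (M : MonadOps) : Set₁ where
  open MonadOps M
  field
    bind-η-left  : {X Y : Set} (x : X) (f : X → T Y) → bind (η x) f ≡ f x
    bind-η-right : {X : Set} (p : T X) → bind p η ≡ p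
    bind-assoc   : {X Y Z : Set} (p : T X) (f : X → T Y) (g : Y → T Z) →
                   bind (bind p f) g ≡ bind p (λ x → bind (f x) g)
    bind-cong    : {X Y : Set} (p : T X) (f g : X → T Y) →
                   (∀ x → f x ≡ g x) → bind p f ≡ bind p g

record Monad : Set₁ where
  field
    ops     : MonadOps
    isMonad : IsMonad ops
  open MonadOps ops public
  open IsMonad isMonad public

-- Eilenberg–Moore algebra laws for a : T B → B:
--   a ∘ η = id   and   a ∘ μ = a ∘ T a   (the latter in Kleisli form).
record IsAlgebra (M : MonadOps) {B : Set} (a : MonadOps.T M B → B) : Set₁ where
  open MonadOps M
  field
    alg-unit : (b : B) → a (η b) ≡ b
    alg-mult : {Y : Set} (p : T Y) (f : Y → T B) → a (bind p f) ≡ a (fmap (a ∘ f) p)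

FinitelyGenerated : (M : MonadOps) {B : Set} (a : MonadOps.T M B → B) → Set
FinitelyGenerated M {B} a =
  Σ ℕ λ r → Σ (Fin r → B) λ g → (b : B) → ∃ λ p → a (MonadOps.fmap M g p) ≡ b

-- A T-automaton over input alphabet A, output algebra B, state set X
-- (without laws, so that it also makes sense for the continuation monad).
record Automaton (M : MonadOps) (A B X : Set) : Set where
  open MonadOps M
  field
    o : X → B
    t : A → X → T X
    a : T B → B

-- Unique L-coalgebra morphism  S → B^{A*}  for L = B × (-)^A, from
-- a coalgebra ⟨out , step⟩ : S → B × S^A:
--   beh s [] = out s ,  beh s (a ∷ w) = beh (step a s) w .
beh : {A B S : Set} → (S → B) → (A → S → S) → S → List A → B
beh out step s []      = out s
beh out step s (c ∷ w) = beh out step (step c s) w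

-- Generalized powerset construction: the T-algebra morphism TX → B × (TX)^A
-- extending ⟨o , t⟩ along η is ⟨ a ∘ T o , λ c → (t c)^* ⟩.
module _ {M : MonadOps} {A B X : Set} (m : Automaton M A B X) where
  open MonadOps M
  open Automaton m

  out♯ : T X → B
  out♯ p = a (fmap o p)

  step♯ : A → T X → T X
  step♯ c p = bind p (t c)

  ⟦_⟧ : X → List A → B
  ⟦ x ⟧ = beh out♯ step♯ (η x)

-- Continuation monad T_B X = B^(B^X), only as monad data (its laws would
-- need function extensionality; the semantics does not use them).
Cont : Set → MonadOps
Cont B = record
  { T    = λ X → (X → B) → B
  ; η    = λ x f → f x
  ; bind = λ k f c → k (λ x → f x c)
  }

κ : (M : MonadOps) {B X : Set} → (MonadOps.T M B → B) → MonadOps.T M X → (X → B) → B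
κ M a p f = a (MonadOps.fmap M f p)

CPS : {M : MonadOps} {A B X : Set} → Automaton M A B X → Automaton (Cont B) A B X
CPS {M} m = record
  { o = Automaton.o m
  ; t = λ c x → κ M (Automaton.a m) (Automaton.t m c x)
  ; a = λ k → k id
  }

-- The CPS-transform replaces a distribution of states p : T X by the
-- continuation κ p = λ g → a (T g p).  Since κ is a monad morphism (it sends
-- η to η by the unit law and bind to bind by the multiplication law of the
-- algebra a), the relation "K is κ p" is a bisimulation between the
-- determinised automata of m and of m_*, and related states have equal traces.
module Submission where

open import Defs
open import Data.Nat using (ℕ)
open import Data.Fin using (Fin)
open import Data.List using (List; []; _∷_)
open import Function using (_∘_)
open import Relation.Binary.PropositionalEquality using (_≡_; sym; cong; module ≡-Reasoning)
open ≡-Reasoning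

beh-cong : {A B S S′ : Set} {out : S → B} {step : A → S → S}
           {out′ : S′ → B} {step′ : A → S′ → S′} (R : S → S′ → Set) →
           (∀ {s s′} → R s s′ → out s ≡ out′ s′) →
           (∀ c {s s′} → R s s′ → R (step c s) (step′ c s′)) →
           ∀ {s s′} → R s s′ → (w : List A) → beh out step s w ≡ beh out′ step′ s′ w
beh-cong R out-≡ step-R s~s′ []      = out-≡ s~s′
beh-cong R out-≡ step-R s~s′ (c ∷ w) = beh-cong R out-≡ step-R (step-R c s~s′) w

module _ (M : Monad) {B : Set} {a : Monad.T M B → B} (alg : IsAlgebra (Monad.ops M) a) where
  open Monad M
  open IsAlgebra alg

  κ-η : {X : Set} (x : X) (g : X → B) → κ ops a (η x) g ≡ g x
  κ-η x g = begin
    a (bind (η x) (η ∘ g)) ≡⟨ cong a (bind-η-left x (η ∘ g)) ⟩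
    a (η (g x))            ≡⟨ alg-unit (g x) ⟩
    g x                    ∎

  κ-bind : {X Y : Set} (p : T X) (f : X → T Y) (g : Y → B) →
           κ ops a (bind p f) g ≡ κ ops a p (λ x → κ ops a (f x) g)
  κ-bind p f g = begin
    a (bind (bind p f) (η ∘ g))         ≡⟨ cong a (bind-assoc p f (η ∘ g)) ⟩
    a (bind p (λ x → fmap g (f x)))     ≡⟨ alg-mult p (λ x → fmap g (f x)) ⟩
    a (fmap (λ x → a (fmap g (f x))) p) ∎

module _ (M : Monad) {A B X : Set} (m : Automaton (Monad.ops M) A B X)
         (alg : IsAlgebra (Monad.ops M) (Automaton.a m)) where
  open Monad M
  open Automaton m

  _≈κ_ : T X → ((X → B) → B) → Set
  p ≈κ K = ∀ g → K g ≡ κ ops a p g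

  ≈κ-step : ∀ c {p K} → p ≈κ K → step♯ m c p ≈κ step♯ (CPS m) c K
  ≈κ-step c {p} {K} p≈K g = begin
    K (λ x → κ ops a (t c x) g)         ≡⟨ p≈K _ ⟩
    κ ops a p (λ x → κ ops a (t c x) g) ≡⟨ sym (κ-bind M alg p (t c) g) ⟩
    κ ops a (bind p (t c)) g            ∎

  beh-CPS : ∀ {p K} → p ≈κ K → (w : List A) →
            beh (out♯ m) (step♯ m) p w ≡ beh (out♯ (CPS m)) (step♯ (CPS m)) K w
  beh-CPS = beh-cong _≈κ_ (λ p≈K → sym (p≈K o)) ≈κ-step

theorem7 : (M : Monad) (k n : ℕ) (B : Set)
           (m : Automaton (Monad.ops M) (Fin k) B (Fin n)) →
           IsAlgebra (Monad.ops M) (Automaton.a m) →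
           FinitelyGenerated (Monad.ops M) (Automaton.a m) →
           (x : Fin n) (w : List (Fin k)) →
           ⟦ m ⟧ x w ≡ ⟦ CPS m ⟧ x w
theorem7 M k n B m alg _ x =
  beh-CPS M m alg (λ g → sym (κ-η M alg x g))
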